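{- Let $d \geq 3$ and $n\ge 1$ be integers. For every vertex $y$ of the undirected de Bruijn graph $\mathcal{B}(d,n)$ there exists a vertex $x$ with $d(y,x)=n$, where $d(\cdot,\cdot)$ is the graph distance in $\mathcal{B}(d,n)$.
   Context: Let $[d]=\{0,1,\ldots,d-1\}$. The undirected de Bruijn graph $\mathcal{B}(d,n)$ has vertex set the set of all strings of length $n$ over $[d]$, and for each string $x_1x_2\ldots x_{n+1}$ over $[d]$ an (undirected) edge joining $x_1\ldots x_n$ and $x_2\ldots x_{n+1}$. -}

module Defs where

open import Data.Nat using (ℕ; suc; _<_)
open import Data.Fin using (Fin)
open import Data.Vec using (Vec; init; tail)
open import Data.Product using (Σ; _×_; ∃)
open import Data.Sum using (_⊎_)
open import Relation.Binary.PropositionalEquality using (_≡_)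
open import Relation.Nullary using (¬_)

Vertex : ℕ → ℕ → Set
Vertex d n = Vec (Fin d) n

-- Each string x₁…x_{n+1} yields an edge joining x₁…xₙ (init) and x₂…x_{n+1} (tail).
-- Since edges are undirected, u and v are adjacent if such a string exists in either orientation.
Adj : (d n : ℕ) → Vertex d n → Vertex d n → Set
Adj d n u v =
  Σ (Vec (Fin d) (suc n)) λ s →
    (init s ≡ u × tail s ≡ v) ⊎ (init s ≡ v × tail s ≡ u)

data Walk (d n : ℕ) : ℕ → Vertex d n → Vertex d n → Set where
  here : ∀ {u} → Walk d n 0 u u
  step : ∀ {k u v w} → Adj d n u v → Walk d n k v w → Walk d n (suc k) u w

Dist : (d n : ℕ) → Vertex d n → Vertex d n → ℕ → Set
Dist d n u v k = Walk d n k u v × (∀ j → j < k → ¬ Walk d n j u v)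

-- Upper bound: any two strings y and x are the first and last length-n windows of the word y x, and
-- sliding the window along it is a walk of length n.
--
-- Lower bound: along a walk of length k from u to w, track a block u[i, i+ℓ) reappearing in w as
-- w[j, j+ℓ).  An edge either shifts the block by one position or loses one of its end letters, so
-- i + j ≤ k and the potential k + 2ℓ + i + j never drops below its initial value 2n.  When
-- k < n, the block is then long enough to contain a position t with (i+t) + (j+t) ∈ {n-1, n-2}.
-- So if x is chosen so that its letter at q differs from the letters of y at n-1-q and n-2-q
-- (possible with three letters), no walk of length k < n joins y to x.
module Submission where

open import Defs
open import Data.Nat using (ℕ; zero; suc; _+_; _∸_; _≤_; _<_; z≤n; s≤s)
open import Data.Nat.Properties
open import Data.Nat.Tactic.RingSolver using (solve-∀)
open import Data.Fin using (Fin; zero; suc) renaming (_≟_ to _≟ᶠ_)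
open import Data.Vec using (Vec; []; _∷_; init; tail)
open import Data.Maybe using (Maybe; just; nothing)
open import Data.Maybe.Properties using (just-injective; ≡-dec)
open import Data.Product using (Σ; ∃; _×_; _,_; proj₁; proj₂)
open import Data.Sum using (_⊎_; inj₁; inj₂)
open import Data.Empty using (⊥)
open import Function using (_∘_)
open import Relation.Nullary using (¬_; yes; no)
open import Relation.Binary.PropositionalEquality

private
  variable
    A : Set
    d n k : ℕ

prepend : Vec A n → (ℕ → A) → ℕ → A
prepend []      z m       = z m
prepend (a ∷ v) z zero    = a
prepend (a ∷ v) z (suc m) = prepend v z m

prepend-+ : (v : Vec A n) (z : ℕ → A) (m : ℕ) → prepend v z (n + m) ≡ z m
prepend-+ []      z m = refl
prepend-+ (a ∷ v) z m = prepend-+ v z m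

window : (n : ℕ) → (ℕ → A) → Vec A n
window zero    z = []
window (suc n) z = z 0 ∷ window n (z ∘ suc)

window-cong : ∀ n {f g : ℕ → A} → (∀ m → f m ≡ g m) → window n f ≡ window n g
window-cong zero    f≗g = refl
window-cong (suc n) f≗g = cong₂ _∷_ (f≗g 0) (window-cong n (f≗g ∘ suc))

window-prepend : (v : Vec A n) (z : ℕ → A) → window n (prepend v z) ≡ v
window-prepend []      z = refl
window-prepend (a ∷ v) z = cong (a ∷_) (window-prepend v z)

init-window : ∀ n (z : ℕ → A) → init (window (suc n) z) ≡ window n z
init-window zero    z = refl
init-window (suc n) z = cong (z 0 ∷_) (init-window n (z ∘ suc))

window-adjacent : (z : ℕ → Fin d) → Adj d n (window n z) (window n (z ∘ suc))
window-adjacent {n = n} z = window (suc n) z , inj₁ (init-window n z , refl)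

slide : ∀ m (z : ℕ → Fin d) → Walk d n m (window n z) (window n (λ p → z (m + p)))
slide zero    z = here
slide (suc m) z = step (window-adjacent z) (slide m (z ∘ suc))

walk-of-length-n : (u v : Vertex (suc d) n) → Walk (suc d) n n u v
walk-of-length-n {d} {n} u v =
  subst₂ (Walk (suc d) n n)
    (window-prepend u word-after-u)
    (trans (window-cong n (prepend-+ u word-after-u)) (window-prepend v _))
    (slide n (prepend u word-after-u))
  where
  word-after-u : ℕ → Fin (suc d)
  word-after-u = prepend v (λ _ → zero)

at : Vec A n → ℕ → Maybe A
at []      m       = nothing
at (a ∷ v) zero    = just a
at (a ∷ v) (suc m) = at v m

at-init : (s : Vec A (suc n)) (m : ℕ) → m < n → at (init s) m ≡ at s m
at-init {n = suc n} (a ∷ s) zero    _         = refl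
at-init {n = suc n} (a ∷ s) (suc m) (s≤s m<n) = at-init s m m<n

at-tail : (s : Vec A (suc n)) (m : ℕ) → at (tail s) m ≡ at s (suc m)
at-tail (a ∷ s) m = refl

at-window : ∀ n (z : ℕ → A) m → m < n → at (window n z) m ≡ just (z m)
at-window (suc n) z zero    _         = refl
at-window (suc n) z (suc m) (s≤s m<n) = at-window n (z ∘ suc) m m<n

record Overlap (k : ℕ) (u w : Vec A n) : Set where
  constructor shared
  field
    i j ℓ     : ℕ
    i+ℓ≤n     : i + ℓ ≤ n
    j+ℓ≤n     : j + ℓ ≤ n
    i+j≤k     : i + j ≤ k
    potential : n + n ≤ k + (ℓ + ℓ + (i + j))
    agree     : ∀ t → t < ℓ → at u (i + t) ≡ at w (j + t)

overlap-refl : (u : Vec A n) → Overlap 0 u u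
overlap-refl {n = n} u =
  shared 0 0 n ≤-refl ≤-refl z≤n (≤-reflexive (sym (+-identityʳ (n + n)))) (λ _ _ → refl)

overlap-empty : (u : Vec A n) {v w : Vec A n} (o : Overlap k v w) → Overlap.ℓ o ≡ 0 → Overlap (suc k) u w
overlap-empty u (shared i j zero i+ℓ≤n j+ℓ≤n i+j≤k pot _) refl =
  shared i j 0 i+ℓ≤n j+ℓ≤n (m≤n⇒m≤1+n i+j≤k) (m≤n⇒m≤1+n pot) (λ _ ())

shrink-potential : ∀ k ℓ m → k + (suc ℓ + suc ℓ + m) ≡ suc k + (ℓ + ℓ + suc m)
shrink-potential = solve-∀

shift-potential : ∀ k p m → k + (p + suc m) ≡ suc k + (p + m)
shift-potential = solve-∀

inside-block : ∀ i {ℓ t} → i + ℓ ≤ n → t < ℓ → i + t < n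
inside-block i i+ℓ≤n t<ℓ = <-≤-trans (+-monoʳ-< i t<ℓ) i+ℓ≤n

inside-block-suc : ∀ i {ℓ t} → i + suc ℓ ≤ n → t < ℓ → suc (i + t) < n
inside-block-suc {n = n} i i+ℓ≤n t<ℓ = subst (_< n) (+-suc i _) (inside-block i i+ℓ≤n (s≤s t<ℓ))

-- The last letter of the block is dropped even when it would still fit; this keeps the
-- potential constant.
overlap-init : (s : Vec A (suc n)) {w : Vec A n} → Overlap k (tail s) w → Overlap (suc k) (init s) w
overlap-init s o@(shared _ _ zero _ _ _ _ _) = overlap-empty (init s) o refl
overlap-init {n = n} {k = k} s {w} (shared i j (suc ℓ) i+ℓ≤n j+ℓ≤n i+j≤k pot agree) =
  shared (suc i) j ℓ (subst (_≤ n) (+-suc i ℓ) i+ℓ≤n) (≤-trans (+-monoʳ-≤ j (n≤1+n ℓ)) j+ℓ≤n)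
    (s≤s i+j≤k) (≤-trans pot (≤-reflexive (shrink-potential k ℓ (i + j)))) agree′
  where
  agree′ : ∀ t → t < ℓ → at (init s) (suc i + t) ≡ at w (j + t)
  agree′ t t<ℓ = begin
    at (init s) (suc (i + t)) ≡⟨ at-init s (suc (i + t)) (inside-block-suc i i+ℓ≤n t<ℓ) ⟩
    at s (suc (i + t))        ≡⟨ at-tail s (i + t) ⟨
    at (tail s) (i + t)       ≡⟨ agree t (m<n⇒m<1+n t<ℓ) ⟩
    at w (j + t)              ∎
    where open ≡-Reasoning

overlap-tail : (s : Vec A (suc n)) {w : Vec A n} → Overlap k (init s) w → Overlap (suc k) (tail s) w
overlap-tail s o@(shared _ _ zero _ _ _ _ _) = overlap-empty (tail s) o refl
overlap-tail {k = k} s {w} (shared (suc i) j ℓ i+ℓ≤n j+ℓ≤n i+j≤k pot agree) =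
  shared i j ℓ (≤-trans (n≤1+n _) i+ℓ≤n) j+ℓ≤n (m<n⇒m≤1+n i+j≤k)
    (≤-trans pot (≤-reflexive (shift-potential k (ℓ + ℓ) (i + j)))) agree′
  where
  agree′ : ∀ t → t < ℓ → at (tail s) (i + t) ≡ at w (j + t)
  agree′ t t<ℓ = begin
    at (tail s) (i + t)       ≡⟨ at-tail s (i + t) ⟩
    at s (suc (i + t))        ≡⟨ at-init s (suc (i + t)) (inside-block (suc i) i+ℓ≤n t<ℓ) ⟨
    at (init s) (suc (i + t)) ≡⟨ agree t t<ℓ ⟩
    at w (j + t)              ∎
    where open ≡-Reasoning
overlap-tail {n = n} {k = k} s {w} (shared zero j (suc ℓ) i+ℓ≤n j+ℓ≤n i+j≤k pot agree) =
  shared 0 (suc j) ℓ (≤-trans (n≤1+n ℓ) i+ℓ≤n) (subst (_≤ n) (+-suc j ℓ) j+ℓ≤n) (s≤s i+j≤k)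
    (≤-trans pot (≤-reflexive (shrink-potential k ℓ j))) agree′
  where
  agree′ : ∀ t → t < ℓ → at (tail s) t ≡ at w (suc j + t)
  agree′ t t<ℓ = begin
    at (tail s) t       ≡⟨ at-tail s t ⟩
    at s (suc t)        ≡⟨ at-init s (suc t) (inside-block-suc 0 i+ℓ≤n t<ℓ) ⟨
    at (init s) (suc t) ≡⟨ agree (suc t) (s≤s t<ℓ) ⟩
    at w (j + suc t)    ≡⟨ cong (at w) (+-suc j t) ⟩
    at w (suc j + t)    ∎
    where open ≡-Reasoning

walk⇒overlap : {u w : Vertex d n} → Walk d n k u w → Overlap k u w
walk⇒overlap {u = u} here                         = overlap-refl u
walk⇒overlap (step (s , inj₁ (refl , refl)) walk) = overlap-init s (walk⇒overlap walk)
walk⇒overlap (step (s , inj₂ (refl , refl)) walk) = overlap-tail s (walk⇒overlap walk)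

Mirrored : ℕ → ℕ → ℕ → Set
Mirrored n p q = p + q ≡ n ⊎ suc (p + q) ≡ n

halve : ∀ s → ∃ λ t → t + t ≡ s ⊎ suc (t + t) ≡ s
halve zero = 0 , inj₁ refl
halve (suc s) with halve s
... | t , inj₁ t+t≡s   = t , inj₂ (cong suc t+t≡s)
... | t , inj₂ t+t+1≡s = suc t , inj₁ (cong suc (trans (+-suc t t) t+t+1≡s))

interleave : ∀ i j t → (i + t) + (j + t) ≡ (i + j) + (t + t)
interleave = solve-∀

-- t is half the slack n - (i + j); the potential forces t < ℓ.
overlap-crossing : {u w : Vec A (suc n)} (o : Overlap k u w) → k ≤ n →
                   ∃ λ t → t < Overlap.ℓ o × Mirrored n (Overlap.i o + t) (Overlap.j o + t)
overlap-crossing {n = n} {k = k} (shared i j ℓ _ _ i+j≤k pot _) k≤n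
  with m≤n⇒∃[o]m+o≡n (≤-trans i+j≤k k≤n)
... | s , i+j+s≡n with halve s
... | t , parity = t , t<ℓ , mirrored parity
  where
  halve-≤ : t + t ≡ s ⊎ suc (t + t) ≡ s → t + t ≤ s
  halve-≤ (inj₁ t+t≡s)   = ≤-reflexive t+t≡s
  halve-≤ (inj₂ t+t+1≡s) = ≤-trans (n≤1+n _) (≤-reflexive t+t+1≡s)

  t<ℓ : t < ℓ
  t<ℓ = ≰⇒> λ ℓ≤t → <⇒≱ (+-mono-< (n<1+n n) (n<1+n n)) (begin
    suc n + suc n         ≤⟨ pot ⟩
    k + (ℓ + ℓ + (i + j)) ≤⟨ +-mono-≤ k≤n (+-monoˡ-≤ (i + j) (+-mono-≤ ℓ≤t ℓ≤t)) ⟩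
    n + (t + t + (i + j)) ≤⟨ +-monoʳ-≤ n (+-monoˡ-≤ (i + j) (halve-≤ parity)) ⟩
    n + (s + (i + j))     ≡⟨ cong (n +_) (trans (+-comm s (i + j)) i+j+s≡n) ⟩
    n + n                 ∎)
    where open ≤-Reasoning

  mirrored : t + t ≡ s ⊎ suc (t + t) ≡ s → Mirrored n (i + t) (j + t)
  mirrored (inj₁ t+t≡s) = inj₁ (trans (interleave i j t) (trans (cong (i + j +_) t+t≡s) i+j+s≡n))
  mirrored (inj₂ t+t+1≡s) = inj₂ (begin
    suc ((i + t) + (j + t)) ≡⟨ cong suc (interleave i j t) ⟩
    suc ((i + j) + (t + t)) ≡⟨ +-suc (i + j) (t + t) ⟨
    (i + j) + suc (t + t)   ≡⟨ cong (i + j +_) t+t+1≡s ⟩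
    (i + j) + s             ≡⟨ i+j+s≡n ⟩
    n                       ∎)
    where open ≡-Reasoning

fresh-nonzero : (a : Maybe (Fin (3 + d))) → ∃ λ c → c ≢ zero × just c ≢ a
fresh-nonzero a with ≡-dec _≟ᶠ_ (just (suc zero)) a
... | no 1≢a   = suc zero , (λ ()) , 1≢a
... | yes refl = suc (suc zero) , (λ ()) , (λ ())

fresh : (a b : Maybe (Fin (3 + d))) → ∃ λ c → just c ≢ a × just c ≢ b
fresh a b with ≡-dec _≟ᶠ_ (just zero) a | ≡-dec _≟ᶠ_ (just zero) b
... | no 0≢a   | no 0≢b   = zero , 0≢a , 0≢b
... | yes refl | _        = let c , c≢0 , c≢b = fresh-nonzero b in c , c≢0 ∘ just-injective , c≢b
... | no _     | yes refl = let c , c≢0 , c≢a = fresh-nonzero a in c , c≢a , c≢0 ∘ just-injective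

opposite-letter : (y : Vertex (3 + d) (suc n)) (q : ℕ) →
                  ∃ λ c → just c ≢ at y (n ∸ q) × just c ≢ at y (n ∸ suc q)
opposite-letter {n = n} y q = fresh (at y (n ∸ q)) (at y (n ∸ suc q))

opposite : Vertex (3 + d) (suc n) → Vertex (3 + d) (suc n)
opposite {n = n} y = window (suc n) (proj₁ ∘ opposite-letter y)

opposite-avoids : (y : Vertex (3 + d) (suc n)) {p q : ℕ} → q < suc n → Mirrored n p q →
                  at y p ≢ at (opposite y) q
opposite-avoids {n = n} y {p} {q} q<n mirrored y≡x = collide mirrored
  where
  letter : ∃ λ c → just c ≢ at y (n ∸ q) × just c ≢ at y (n ∸ suc q)
  letter = opposite-letter y q

  hit : just (proj₁ letter) ≡ at y p
  hit = sym (trans y≡x (at-window (suc n) (proj₁ ∘ opposite-letter y) q q<n))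

  collide : Mirrored n p q → ⊥
  collide (inj₁ p+q≡n) = proj₁ (proj₂ letter) (begin
    just (proj₁ letter) ≡⟨ hit ⟩
    at y p              ≡⟨ cong (at y) (m+n∸n≡m p q) ⟨
    at y (p + q ∸ q)    ≡⟨ cong (λ m → at y (m ∸ q)) p+q≡n ⟩
    at y (n ∸ q)        ∎)
    where open ≡-Reasoning
  collide (inj₂ p+q+1≡n) = proj₂ (proj₂ letter) (begin
    just (proj₁ letter)        ≡⟨ hit ⟩
    at y p                     ≡⟨ cong (at y) (m+n∸n≡m p q) ⟨
    at y (suc (p + q) ∸ suc q) ≡⟨ cong (λ m → at y (m ∸ suc q)) p+q+1≡n ⟩
    at y (n ∸ suc q)           ∎)
    where open ≡-Reasoning

opposite-far : (y : Vertex (3 + d) (suc n)) → k ≤ n → ¬ Walk (3 + d) (suc n) k y (opposite y)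
opposite-far y k≤n walk =
  let o = walk⇒overlap walk
      t , t<ℓ , mirrored = overlap-crossing o k≤n
  in opposite-avoids y (inside-block (Overlap.j o) (Overlap.j+ℓ≤n o) t<ℓ) mirrored (Overlap.agree o t t<ℓ)

mainTheorem4 : (d n : ℕ) → 3 ≤ d → 1 ≤ n →
    (y : Vertex d n) → Σ (Vertex d n) λ x → Dist d n y x n
mainTheorem4 (suc (suc (suc d))) (suc n) (s≤s (s≤s (s≤s _))) (s≤s _) y =
  opposite y , walk-of-length-n y (opposite y) , λ k k<n → opposite-far y (m<1+n⇒m≤n k<n)
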